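{- Let $H=(V,\mathcal{E})$ be an admissible hypergraph (defined in the context), and consider any execution of Algorithm LocalHypColoring on $H$ with any red-blue colorings $C_1,\ldots,C_x$ of $V$. For $i\ge 0$ let $V_i\subseteq V$ be the set of vertices whose colour has not been fixed (non-idle vertices) at the end of phase $i$, and $\mathcal{E}_i\subseteq\mathcal{E}$ the set of non-idle hyperedges at the end of phase $i$, with $V_0=V$, $\mathcal{E}_0=\mathcal{E}$. Then for every phase $i\le x$ and every hyperedge $f\in\mathcal{E}_i$: (a) all vertices of $f\setminus V_i$ have been fixed to one and the same colour, and (b) $|f\cap V_i|\ge\alpha\delta$.
   Context: Problem: given a hypergraph $H=(V,\mathcal{E})$, colour the vertices red/blue so that every hyperedge is bi-chromatic (contains a red and a blue vertex). LOCAL model: the communication network is the bipartite incidence graph of $H$ (one node per vertex, one per hyperedge, a link between a vertex and each hyperedge containing it); computation proceeds in synchronous rounds, in each of which every node sends a message to all neighbours and performs arbitrary local computation. Each node knows $n$ and its incident vertices/hyperedges. A hypergraph is admissible (for parameter $n$) if it has $n$ vertices and $n$ hyperedges, each hyperedge containing exactly $\delta$ vertices, where $c\ln^2 n\le\delta\le\log^{O(1)}n$ for a sufficiently large constant $c$; $0<\alpha<1/2$ is a constant with $2e(n+1)\le 2^{\alpha\delta}$. The intersection graph $G(H)$ has the hyperedges as nodes, two adjacent iff they intersect. A set $T$ of hyperedges is a connected $1,2$-component if for any $x,y\in T$ there is a path in $G(H)$ from $x$ to $y$ such that of any two consecutive hyperedges on the path at least one lies in $T$. Algorithm LocalHypColoring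 (parameters: constant integer $u>2$, number of phases $x$, colourings $C_1,\dots,C_x$ of $V$, each vertex knowing its own colours). Initially no vertex is fixed and no node is idle. In phase $i=1,\dots,x$: each non-fixed vertex $v$ temporarily takes colour $C_i(v)$; fixed vertices keep their fixed colours. With respect to this colouring (all vertices of a hyperedge counted), a hyperedge is biased if at most $\alpha\delta$ of its vertices are red or at most $\alpha\delta$ are blue; a vertex is bad if it lies in a biased hyperedge, otherwise good; a hyperedge is dangerous if it contains at least $\alpha\delta$ bad vertices. Non-idle nodes run $y=6u+2$ rounds of flooding their knowledge of the topology and colours of non-idle nodes. At the end of the phase: every non-fixed good vertex fixes its colour $C_i(v)$. For every maximal connected $1,2$-component $T$ of biased (non-idle) hyperedges of diameter smaller than $3u$ in $G(H)$, let $T'$ be $T$ together with the dangerous non-biased hyperedges intersecting it; each non-fixed vertex of $T'$ runs locally the same fixed deterministic sequential hypergraph bi-chromatic colouring algorithm on its identical copy of $T'$, recolouring only non-fixed vertices so that every hyperedge of $T'$ becomes bi-chromatic, and fixes the colour it receives. A vertex all of whose hyperedges have bi-chromatic sets of fixed vertices also fixes its colour. Vertices with fixed colours become idle. A hyperedge stays non-idle for the next phase only if its set of fixed-colour vertices is monochromatic and it still contains a non-fixed vertex; otherwise it becomes idle. Idle nodes stay idle forever.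
   Formalization: The constant α, with 0 < α < 1/2, is taken to be a rational number. -}

module Defs where

open import Data.Nat using (ℕ; zero; suc; _<_)
open import Data.Bool using (Bool; true; false; not; _∧_; _∨_)
open import Data.Fin using (Fin; toℕ)
open import Data.Fin.Subset using (Subset; _∈_; _∉_; _∩_; ∣_∣)
open import Data.Vec using (tabulate; lookup)
open import Data.List using (allFin)
import Data.Bool.ListAction as L
open import Data.Integer using (+_)
open import Data.Rational using (ℚ; _/_; _*_; _≤_; _≤ᵇ_)
open import Data.Product using (Σ; ∃; ∃-syntax; _×_)
open import Data.Sum using (_⊎_)
open import Relation.Binary.PropositionalEquality using (_≡_)
open import Relation.Nullary using (¬_)
import Data.Bool
import Data.Nat

infix 3 _⇔_
_⇔_ : Set → Set → Set
A ⇔ B = (A → B) × (B → A)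

ℕ→ℚ : ℕ → ℚ
ℕ→ℚ k = + k / 1

-- Convention: colour true = red, false = blue.
-- A hypergraph on vertex set Fin n with hyperedges indexed by Fin m:
-- E e is the set of vertices of hyperedge e.

record State (n : ℕ) : Set where
  field
    fixed  : Fin n → Bool   -- vertex colour has been fixed (vertex idle)
    colour : Fin n → Bool   -- fixed colour (meaningful for fixed vertices)
    idle   : Fin n → Bool   -- hyperedge is idle

open State public

initial : ∀ {n} → State n
initial = record { fixed = λ _ → false ; colour = λ _ → false ; idle = λ _ → false }

module Alg {n : ℕ} (E : Fin n → Subset n) (δ : ℕ) (α : ℚ) (u : ℕ) where

  αδ : ℚ
  αδ = α * ℕ→ℚ δ

  Adj : Fin n → Fin n → Set
  Adj e e' = ∃[ v ] (v ∈ E e × v ∈ E e')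

  data Walk : ℕ → Fin n → Fin n → Set where
    here : ∀ {a} → Walk zero a a
    step : ∀ {k a b c} → Adj a b → Walk k b c → Walk (suc k) a c

  DiamLt3u : Subset n → Set
  DiamLt3u T = ∀ a b → a ∈ T → b ∈ T → ∃[ k ] (k < 3 Data.Nat.* u × Walk k a b)

  data Walk12 (T : Subset n) : Fin n → Fin n → Set where
    here : ∀ {a} → Walk12 T a a
    step : ∀ {a b c} → Adj a b → (a ∈ T ⊎ b ∈ T) → Walk12 T b c → Walk12 T a c

  Connected12 : Subset n → Set
  Connected12 T = ∀ a b → a ∈ T → b ∈ T → Walk12 T a b

  anyFin : (Fin n → Bool) → Bool
  anyFin p = L.any p (allFin n)

  module Phase (Ci : Fin n → Bool) (s : State n) where

    cur : Fin n → Bool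
    cur v = Data.Bool.if fixed s v then colour s v else Ci v

    redCount : Fin n → ℕ
    redCount e = ∣ E e ∩ tabulate cur ∣

    blueCount : Fin n → ℕ
    blueCount e = ∣ E e ∩ tabulate (λ v → not (cur v)) ∣

    biasedᵇ : Fin n → Bool
    biasedᵇ e = not (idle s e) ∧ ((ℕ→ℚ (redCount e) ≤ᵇ αδ) ∨ (ℕ→ℚ (blueCount e) ≤ᵇ αδ))

    Biased : Fin n → Set
    Biased e = biasedᵇ e ≡ true

    badᵇ : Fin n → Bool
    badᵇ v = anyFin (λ e → biasedᵇ e ∧ lookup (E e) v)

    Bad Good : Fin n → Set
    Bad v = badᵇ v ≡ true
    Good v = badᵇ v ≡ false

    Dangerous : Fin n → Set
    Dangerous e = idle s e ≡ false × αδ ≤ ℕ→ℚ ∣ E e ∩ tabulate badᵇ ∣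

    MaxComp : Subset n → Set
    MaxComp T = (∃[ e ] e ∈ T)
              × (∀ e → e ∈ T → Biased e)
              × Connected12 T
              × (∀ T₂ → (∀ e → e ∈ T → e ∈ T₂) → (∀ e → e ∈ T₂ → Biased e)
                      → Connected12 T₂ → ∀ e → e ∈ T₂ → e ∈ T)

    -- the components on which the sequential algorithm is run
    Small : Subset n → Set
    Small T = MaxComp T × DiamLt3u T

    InT' : Subset n → Fin n → Set
    InT' T g = g ∈ T ⊎ (Dangerous g × ¬ Biased g × ∃[ e ] (e ∈ T × Adj g e))

    VInT' : Fin n → Set
    VInT' v = ∃[ T ] (Small T × ∃[ g ] (InT' T g × v ∈ E g))

    -- fixed after the good vertices fixed their colour
    Fx1 : Fin n → Set
    Fx1 v = fixed s v ≡ true ⊎ Good v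

    -- fixed after the sequential recolouring of the T' components
    Fx2 : Fin n → Set
    Fx2 v = Fx1 v ⊎ VInT' v

    Step : State n → Set
    Step s' =
        -- colours: everything keeps its temporary colour, except non-fixed
        -- vertices recoloured by the sequential algorithm on some T'
        (∀ v → ¬ (¬ Fx1 v × VInT' v) → colour s' v ≡ cur v)
        -- the sequential algorithm makes every hyperedge of T' bi-chromatic
      × (∀ T → Small T → ∀ g → InT' T g →
          ∃[ a ] ∃[ b ] (a ∈ E g × b ∈ E g × colour s' a ≡ true × colour s' b ≡ false))
      × (∀ v → (fixed s' v ≡ true) ⇔
          (Fx2 v ⊎ (∀ g → v ∈ E g →
             ∃[ a ] ∃[ b ] (a ∈ E g × b ∈ E g × Fx2 a × Fx2 b
                           × colour s' a ≡ true × colour s' b ≡ false))))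
      × (∀ e → (idle s' e ≡ false) ⇔
          (idle s e ≡ false
           × (∀ a b → a ∈ E e → b ∈ E e → fixed s' a ≡ true → fixed s' b ≡ true
                 → colour s' a ≡ colour s' b)
           × ∃[ v ] (v ∈ E e × fixed s' v ≡ false)))

  -- an execution of x phases with colourings C (phase toℕ i + 1 uses C i)
  Execution : (x : ℕ) → (Fin x → Fin n → Bool) → (ℕ → State n) → Set
  Execution x C st = (st 0 ≡ initial)
    × (∀ (i : Fin x) → Phase.Step (C i) (st (toℕ i)) (st (suc (toℕ i))))

  nonFixed : State n → Subset n
  nonFixed s = tabulate (λ v → not (fixed s v))

{-# OPTIONS --safe #-}
module Submission where

-- Part (a) is one of the conditions under which a hyperedge stays non-idle.  Part (b) is an
-- induction over the phases; initially all δ ≥ αδ vertices of f are unfixed.  A hyperedge f that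
-- survives a phase lies in no set T′ of a small component T, for then all its vertices would be
-- fixed.  Consequently, if f is biased or dangerous, a bad vertex v of f that was neither fixed
-- nor good stays unfixed: it could only be fixed by lying in some T′, and the biased hyperedge
-- through v then belongs to T by maximality of T, which puts f itself into T′.  If f is biased,
-- all its vertices are bad, so its unfixed vertices stay unfixed.  Otherwise f has more than αδ
-- vertices whose temporary colour is opposite to the common colour of its fixed vertices.  None
-- of them was fixed earlier or is good, as it would then end the phase fixed with that opposite
-- colour; so they are bad, f is dangerous, and they all stay unfixed.

open import Defs
open import Data.Nat using (ℕ; zero; suc; _<_; _≤_)
import Data.Nat.Properties as ℕ
open import Data.Nat.Coprimality as Coprimality using (1-coprimeTo)
open import Data.Bool using (Bool; true; false; not; _∧_; _∨_; _≟_)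
open import Data.Bool.Properties using (∨-zeroʳ; ∧-conicalˡ; ∧-conicalʳ; not-¬; ¬-not; not-injective; T-≡)
import Data.Bool.ListAction as L
open import Data.Fin using (Fin; fromℕ<)
open import Data.Fin.Properties using (toℕ-fromℕ<; any?)
open import Data.Fin.Subset using (Subset; _∈_; _∩_; _∪_; _⊆_; ⁅_⁆; ∣_∣)
open import Data.Fin.Subset.Properties
  using (x∈p∩q⁺; x∈p∩q⁻; x∈p∪q⁺; x∈p∪q⁻; x∈⁅x⁆; x∈⁅y⁆⇒x≡y; p⊆q⇒∣p∣≤∣q∣; _∈?_)
open import Data.Vec using (tabulate; lookup)
open import Data.Vec.Properties using ([]=⇒lookup; lookup⇒[]=; lookup∘tabulate)
open import Data.List using (allFin)
open import Data.List.Membership.Propositional using (lose)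
open import Data.List.Membership.Propositional.Properties using (∈-allFin)
open import Data.List.Relation.Unary.Any using (satisfied)
open import Data.List.Relation.Unary.Any.Properties using (any⁺; any⁻)
open import Data.Integer using (+_; +≤+)
import Data.Integer as ℤ
import Data.Integer.Properties as ℤ
open import Data.Rational using (ℚ; 0ℚ; ½; 1ℚ; mkℚ; *≤*; _≤ᵇ_)
  renaming (_≤_ to _≤ℚ_; _<_ to _<ℚ_; _*_ to _*ℚ_)
open import Data.Rational.Properties using (normalize-coprime; ≤-trans; <⇒≤; ≰⇒>; ≤⇒≤ᵇ; ≤ᵇ⇒≤; *-monoʳ-≤-nonNeg; *-identityˡ)
open import Data.Product using (_×_; _,_; proj₁; proj₂; ∃-syntax)
open import Data.Sum using (_⊎_; inj₁; inj₂; [_,_]′; fromInj₁)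
open import Function using (_∘_)
open import Function.Bundles using (Equivalence)
open import Function.Definitions using (Injective)
open import Relation.Nullary using (¬_; Dec; yes; no; contradiction)
open import Relation.Nullary.Decidable using (_×-dec_)
open import Relation.Binary.PropositionalEquality using (_≡_; refl; sym; trans; cong; cong₂; subst; subst₂)
open Relation.Binary.PropositionalEquality.≡-Reasoning

open Equivalence using (to; from)

ℕ→ℚ≡mkℚ : ∀ m → ℕ→ℚ m ≡ mkℚ (+ m) 0 (Coprimality.sym (1-coprimeTo m))
ℕ→ℚ≡mkℚ m = normalize-coprime (Coprimality.sym (1-coprimeTo m))

ℕ→ℚ-mono : ∀ {m k} → m ≤ k → ℕ→ℚ m ≤ℚ ℕ→ℚ k
ℕ→ℚ-mono {m} {k} m≤k rewrite ℕ→ℚ≡mkℚ m | ℕ→ℚ≡mkℚ k =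
  *≤* (subst₂ ℤ._≤_ (sym (ℤ.*-identityʳ (+ m))) (sym (ℤ.*-identityʳ (+ k))) (+≤+ m≤k))

≤1⇒*ℕ→ℚ≤ℕ→ℚ : ∀ {α} → α ≤ℚ 1ℚ → ∀ k → α *ℚ ℕ→ℚ k ≤ℚ ℕ→ℚ k
≤1⇒*ℕ→ℚ≤ℕ→ℚ {α} α≤1 k rewrite ℕ→ℚ≡mkℚ k =
  subst (α *ℚ k′ ≤ℚ_) (*-identityˡ k′) (*-monoʳ-≤-nonNeg k′ {α} {1ℚ} α≤1)
  where
  k′ : ℚ
  k′ = mkℚ (+ k) 0 (Coprimality.sym (1-coprimeTo k))

module _ {n : ℕ} where

  x∈tabulate⁺ : ∀ (g : Fin n → Bool) {v} → g v ≡ true → v ∈ tabulate g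
  x∈tabulate⁺ g {v} gv = lookup⇒[]= v _ (trans (lookup∘tabulate g v) gv)

  x∈tabulate⁻ : ∀ (g : Fin n → Bool) {v} → v ∈ tabulate g → g v ≡ true
  x∈tabulate⁻ g {v} v∈ = trans (sym (lookup∘tabulate g v)) ([]=⇒lookup v∈)

  ∩-relative-⊆ : ∀ (p q r : Subset n) → (∀ {v} → v ∈ p → v ∈ q → v ∈ r) → p ∩ q ⊆ p ∩ r
  ∩-relative-⊆ p q r p∩q⊆r v∈p∩q =
    let v∈p , v∈q = x∈p∩q⁻ p q v∈p∩q in x∈p∩q⁺ (v∈p , p∩q⊆r v∈p v∈q)

  r≤∣p∣∧p⊆q⇒r≤∣q∣ : ∀ {r : ℚ} {p q : Subset n} → r ≤ℚ ℕ→ℚ ∣ p ∣ → p ⊆ q → r ≤ℚ ℕ→ℚ ∣ q ∣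
  r≤∣p∣∧p⊆q⇒r≤∣q∣ r≤∣p∣ p⊆q = ≤-trans r≤∣p∣ (ℕ→ℚ-mono (p⊆q⇒∣p∣≤∣q∣ p⊆q))

  any-allFin⁺ : ∀ (p : Fin n → Bool) {e} → p e ≡ true → L.any p (allFin n) ≡ true
  any-allFin⁺ p pe = to T-≡ (any⁺ p (lose {xs = allFin n} (∈-allFin _) (from T-≡ pe)))

  any-allFin⁻ : ∀ (p : Fin n → Bool) → L.any p (allFin n) ≡ true → ∃[ e ] p e ≡ true
  any-allFin⁻ p any-p = let e , pe = satisfied (any⁻ p (allFin n) (from T-≡ any-p)) in e , to T-≡ pe

module AlgProperties {n : ℕ} (E : Fin n → Subset n) (δ : ℕ) (α : ℚ) (u : ℕ) where
  open Alg E δ α u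

  Adj-sym : ∀ {a b} → Adj a b → Adj b a
  Adj-sym (v , v∈a , v∈b) = v , v∈b , v∈a

  Walk12-mono : ∀ {T T₂ a b} → T ⊆ T₂ → Walk12 T a b → Walk12 T₂ a b
  Walk12-mono T⊆T₂ here                       = here
  Walk12-mono T⊆T₂ (step a~b (inj₁ a∈T) walk) = step a~b (inj₁ (T⊆T₂ a∈T)) (Walk12-mono T⊆T₂ walk)
  Walk12-mono T⊆T₂ (step a~b (inj₂ b∈T) walk) = step a~b (inj₂ (T⊆T₂ b∈T)) (Walk12-mono T⊆T₂ walk)

  Walk12-++ : ∀ {T a b c} → Walk12 T a b → Walk12 T b c → Walk12 T a c
  Walk12-++ here                walk′ = walk′
  Walk12-++ (step a~b a∨b walk) walk′ = step a~b a∨b (Walk12-++ walk walk′)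

  Connected12-∪⁅⁆ : ∀ {T e g h} → Connected12 T → e ∈ T → Adj e g → Adj g h → Connected12 (T ∪ ⁅ h ⁆)
  Connected12-∪⁅⁆ {T} {e} {g} {h} connected e∈T e~g g~h a b a∈T′ b∈T′ =
    Walk12-++ (toE (x∈p∪q⁻ T ⁅ h ⁆ a∈T′)) (fromE (x∈p∪q⁻ T ⁅ h ⁆ b∈T′))
    where
    T⊆T′ : T ⊆ T ∪ ⁅ h ⁆
    T⊆T′ = x∈p∪q⁺ ∘ inj₁
    h∈T′ : h ∈ T ∪ ⁅ h ⁆
    h∈T′ = x∈p∪q⁺ (inj₂ (x∈⁅x⁆ h))
    toE : ∀ {a} → a ∈ T ⊎ a ∈ ⁅ h ⁆ → Walk12 (T ∪ ⁅ h ⁆) a e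
    toE {a} (inj₁ a∈T) = Walk12-mono T⊆T′ (connected a e a∈T e∈T)
    toE (inj₂ a∈⁅h⁆) with refl ← x∈⁅y⁆⇒x≡y h a∈⁅h⁆ =
      step (Adj-sym g~h) (inj₁ h∈T′) (step (Adj-sym e~g) (inj₂ (T⊆T′ e∈T)) here)
    fromE : ∀ {b} → b ∈ T ⊎ b ∈ ⁅ h ⁆ → Walk12 (T ∪ ⁅ h ⁆) e b
    fromE {b} (inj₁ b∈T) = Walk12-mono T⊆T′ (connected e b e∈T b∈T)
    fromE (inj₂ b∈⁅h⁆) with refl ← x∈⁅y⁆⇒x≡y h b∈⁅h⁆ =
      step e~g (inj₁ (T⊆T′ e∈T)) (step g~h (inj₂ h∈T′) here)

  FixedMonochrome : State n → Fin n → Set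
  FixedMonochrome s e = ∀ a b → a ∈ E e → b ∈ E e → fixed s a ≡ true → fixed s b ≡ true
                        → colour s a ≡ colour s b

  monochrome⇒uniform : ∀ {s e} → FixedMonochrome s e
                     → ∃[ c ] (∀ {v} → v ∈ E e → fixed s v ≡ true → colour s v ≡ c)
  monochrome⇒uniform {s} {e} mono with any? (λ v → (v ∈? E e) ×-dec (fixed s v ≟ true))
  ... | yes (w , w∈e , w-fixed) = colour s w , λ v∈e v-fixed → mono _ _ v∈e w∈e v-fixed w-fixed
  ... | no none                 = true , λ v∈e v-fixed → contradiction (_ , v∈e , v-fixed) none

  ∈nonFixed⁺ : ∀ s {v} → fixed s v ≡ false → v ∈ nonFixed s
  ∈nonFixed⁺ _ v-unfixed = x∈tabulate⁺ _ (cong not v-unfixed)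

  ∈nonFixed⁻ : ∀ s {v} → v ∈ nonFixed s → fixed s v ≡ false
  ∈nonFixed⁻ _ v∈ = not-injective (x∈tabulate⁻ _ v∈)

  module PhaseProperties (Ci : Fin n → Bool) (s : State n) where
    open Phase Ci s

    bad⁺ : ∀ {e v} → Biased e → v ∈ E e → Bad v
    bad⁺ {v = v} be v∈e = any-allFin⁺ (λ e → biasedᵇ e ∧ lookup (E e) v) (cong₂ _∧_ be ([]=⇒lookup v∈e))

    bad⁻ : ∀ {v} → Bad v → ∃[ e ] (Biased e × v ∈ E e)
    bad⁻ {v} bad =
      let e , be∧v∈e = any-allFin⁻ _ bad
      in e , ∧-conicalˡ _ _ be∧v∈e , lookup⇒[]= v (E e) (∧-conicalʳ _ _ be∧v∈e)

    ¬Fx1⇒Bad : ∀ {v} → ¬ Fx1 v → Bad v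
    ¬Fx1⇒Bad ¬fx1 = ¬-not (¬fx1 ∘ inj₂)

    unfixed∧Bad⇒¬Fx1 : ∀ {v} → fixed s v ≡ false → Bad v → ¬ Fx1 v
    unfixed∧Bad⇒¬Fx1 v-unfixed v-bad (inj₁ v-fixed) = contradiction (trans (sym v-fixed) v-unfixed) λ ()
    unfixed∧Bad⇒¬Fx1 v-unfixed v-bad (inj₂ v-good)  = contradiction (trans (sym v-bad) v-good) λ ()

    maxComp-absorbs : ∀ {T e g h} → MaxComp T → e ∈ T → Adj e g → Adj g h → Biased h → h ∈ T
    maxComp-absorbs {T} {h = h} (_ , biased , connected , maximal) e∈T e~g g~h bh =
      maximal (T ∪ ⁅ h ⁆) (λ _ → x∈p∪q⁺ ∘ inj₁) biased′ (Connected12-∪⁅⁆ connected e∈T e~g g~h)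
              h (x∈p∪q⁺ (inj₂ (x∈⁅x⁆ h)))
      where
      biased′ : ∀ x → x ∈ T ∪ ⁅ h ⁆ → Biased x
      biased′ x x∈ = [ biased x , (λ x∈⁅h⁆ → subst Biased (sym (x∈⁅y⁆⇒x≡y h x∈⁅h⁆)) bh) ]′
                       (x∈p∪q⁻ T ⁅ h ⁆ x∈)

    small-absorbs : ∀ {T g v h} → Small T → InT' T g → v ∈ E g → v ∈ E h → Biased h → h ∈ T
    small-absorbs {v = v} (maxT , _) (inj₁ g∈T) v∈g v∈h bh =
      maxComp-absorbs maxT g∈T (v , v∈g , v∈g) (v , v∈g , v∈h) bh
    small-absorbs {v = v} (maxT , _) (inj₂ (_ , _ , e , e∈T , g~e)) v∈g v∈h bh =
      maxComp-absorbs maxT e∈T (Adj-sym g~e) (v , v∈g , v∈h) bh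

    touching-InT' : ∀ {T g v f} → Small T → InT' T g → v ∈ E g → v ∈ E f → Bad v
                  → Biased f ⊎ Dangerous f → InT' T f
    touching-InT' small g∈T′ v∈g v∈f bad (inj₁ bf) = inj₁ (small-absorbs small g∈T′ v∈g v∈f bf)
    touching-InT' {T} {f = f} small g∈T′ v∈g v∈f bad (inj₂ df) = byBias (biasedᵇ f ≟ true)
      where
      byBias : Dec (Biased f) → InT' T f
      byBias (yes bf) = inj₁ (small-absorbs small g∈T′ v∈g v∈f bf)
      byBias (no ¬bf) = let h , bh , v∈h = bad⁻ bad
                        in inj₂ (df , ¬bf , h , small-absorbs small g∈T′ v∈g v∈h bh , _ , v∈f , v∈h)

    ofColour : Bool → Subset n
    ofColour true  = tabulate cur
    ofColour false = tabulate (λ v → not (cur v))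

    ∈ofColour⁻ : ∀ c {v} → v ∈ ofColour c → cur v ≡ c
    ∈ofColour⁻ true  v∈ = x∈tabulate⁻ cur v∈
    ∈ofColour⁻ false v∈ = not-injective (x∈tabulate⁻ _ v∈)

    unbiased⇒manyOfColour : ∀ {e} → idle s e ≡ false → ¬ Biased e → ∀ c → αδ <ℚ ℕ→ℚ ∣ E e ∩ ofColour c ∣
    unbiased⇒manyOfColour {e} active ¬be c = ≰⇒> (¬be ∘ few⇒biased c)
      where
      few⇒biased : ∀ c → ℕ→ℚ ∣ E e ∩ ofColour c ∣ ≤ℚ αδ → Biased e
      few⇒biased true  few =
        cong₂ (λ i red → not i ∧ (red ∨ (ℕ→ℚ (blueCount e) ≤ᵇ αδ))) active (to T-≡ (≤⇒≤ᵇ few))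
      few⇒biased false few =
        trans (cong₂ (λ i blue → not i ∧ ((ℕ→ℚ (redCount e) ≤ᵇ αδ) ∨ blue)) active (to T-≡ (≤⇒≤ᵇ few)))
              (∨-zeroʳ _)

    Fx1⇒colour : ∀ {s′ v} → Step s′ → Fx1 v → colour s′ v ≡ cur v
    Fx1⇒colour (kept , _) fx1 = kept _ (λ (¬fx1 , _) → ¬fx1 fx1)

    Fx2⇒fixed : ∀ {s′ v} → Step s′ → Fx2 v → fixed s′ v ≡ true
    Fx2⇒fixed (_ , _ , fixed-iff , _) fx2 = proj₂ (fixed-iff _) (inj₁ fx2)

    Fx2Bichromatic : State n → Fin n → Set
    Fx2Bichromatic s′ g = ∃[ a ] ∃[ b ] (a ∈ E g × b ∈ E g × Fx2 a × Fx2 b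
                                        × colour s′ a ≡ true × colour s′ b ≡ false)

    module Survivor {s′ : State n} (transition : Step s′) {f : Fin n} (survives : idle s′ f ≡ false) where

      survivalConditions : idle s f ≡ false × FixedMonochrome s′ f × ∃[ w ] (w ∈ E f × fixed s′ w ≡ false)
      survivalConditions = let _ , _ , _ , idle-iff = transition in proj₁ (idle-iff f) survives

      wasActive : idle s f ≡ false
      wasActive = proj₁ survivalConditions

      monochrome : FixedMonochrome s′ f
      monochrome = proj₁ (proj₂ survivalConditions)

      ¬Fx2Bichromatic : ¬ Fx2Bichromatic s′ f
      ¬Fx2Bichromatic (a , b , a∈f , b∈f , fx2a , fx2b , red , blue) =
        contradiction (trans (sym red) (trans (monochrome a b a∈f b∈f (Fx2⇒fixed transition fx2a)
                                                                       (Fx2⇒fixed transition fx2b))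
                                              blue))
                      λ ()

      fixed⇒Fx2 : ∀ {v} → v ∈ E f → fixed s′ v ≡ true → Fx2 v
      fixed⇒Fx2 {v} v∈f v-fixed =
        let _ , _ , fixed-iff , _ = transition
        in fromInj₁ (λ allBichromatic → contradiction (allBichromatic f v∈f) ¬Fx2Bichromatic)
                    (proj₁ (fixed-iff v) v-fixed)

      ∉T' : ∀ {T} → Small T → ¬ InT' T f
      ∉T' {T} small f∈T′ =
        let w , w∈f , w-unfixed = proj₂ (proj₂ survivalConditions)
        in contradiction (trans (sym (Fx2⇒fixed transition (inj₂ (T , small , f , f∈T′ , w∈f)))) w-unfixed)
                         λ ()

      stays-unfixed : ∀ {v} → Biased f ⊎ Dangerous f → v ∈ E f → ¬ Fx1 v → fixed s′ v ≡ false
      stays-unfixed {v} bf⊎df v∈f ¬fx1 = ¬-not (¬Fx2 ∘ fixed⇒Fx2 v∈f)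
        where
        ¬Fx2 : ¬ Fx2 v
        ¬Fx2 (inj₁ fx1)                          = ¬fx1 fx1
        ¬Fx2 (inj₂ (T , small , g , g∈T′ , v∈g)) =
          ∉T' small (touching-InT' small g∈T′ v∈g v∈f (¬Fx1⇒Bad ¬fx1) bf⊎df)

      biased⇒unfixedKept : Biased f → E f ∩ nonFixed s ⊆ E f ∩ nonFixed s′
      biased⇒unfixedKept bf = ∩-relative-⊆ (E f) (nonFixed s) (nonFixed s′) λ v∈f v∈V →
        ∈nonFixed⁺ s′ (stays-unfixed (inj₁ bf) v∈f (unfixed∧Bad⇒¬Fx1 (∈nonFixed⁻ s v∈V) (bad⁺ bf v∈f)))

      unbiased⇒manyUnfixed : ¬ Biased f → αδ ≤ℚ ℕ→ℚ ∣ E f ∩ nonFixed s′ ∣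
      unbiased⇒manyUnfixed ¬bf =
        r≤∣p∣∧p⊆q⇒r≤∣q∣ (<⇒≤ many)
          (∩-relative-⊆ (E f) (ofColour (not c)) (nonFixed s′) λ v∈f v∈P →
             ∈nonFixed⁺ s′ (stays-unfixed (inj₂ dangerous) v∈f (¬Fx1 v∈f v∈P)))
        where
        uniform : ∃[ c ] (∀ {v} → v ∈ E f → fixed s′ v ≡ true → colour s′ v ≡ c)
        uniform = monochrome⇒uniform {s′} {f} monochrome
        c : Bool
        c = proj₁ uniform
        many : αδ <ℚ ℕ→ℚ ∣ E f ∩ ofColour (not c) ∣
        many = unbiased⇒manyOfColour wasActive ¬bf (not c)
        ¬Fx1 : ∀ {v} → v ∈ E f → v ∈ ofColour (not c) → ¬ Fx1 v
        ¬Fx1 {v} v∈f v∈P fx1 = not-¬ refl (begin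
          c            ≡⟨ sym (proj₂ uniform v∈f (Fx2⇒fixed transition (inj₁ fx1))) ⟩
          colour s′ v  ≡⟨ Fx1⇒colour transition fx1 ⟩
          cur v        ≡⟨ ∈ofColour⁻ (not c) v∈P ⟩
          not c        ∎)
        dangerous : Dangerous f
        dangerous = wasActive , r≤∣p∣∧p⊆q⇒r≤∣q∣ (<⇒≤ many)
          (∩-relative-⊆ (E f) (ofColour (not c)) (tabulate badᵇ) λ v∈f v∈P →
             x∈tabulate⁺ badᵇ (¬Fx1⇒Bad (¬Fx1 v∈f v∈P)))

      unfixed-bound-preserved : αδ ≤ℚ ℕ→ℚ ∣ E f ∩ nonFixed s ∣ → αδ ≤ℚ ℕ→ℚ ∣ E f ∩ nonFixed s′ ∣
      unfixed-bound-preserved bound = byBias (biasedᵇ f ≟ true)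
        where
        byBias : Dec (Biased f) → αδ ≤ℚ ℕ→ℚ ∣ E f ∩ nonFixed s′ ∣
        byBias (yes bf) = r≤∣p∣∧p⊆q⇒r≤∣q∣ bound (biased⇒unfixedKept bf)
        byBias (no ¬bf) = unbiased⇒manyUnfixed ¬bf

  module ExecutionProperties (x : ℕ) (C : Fin x → Fin n → Bool) (st : ℕ → State n)
                             (execution : Execution x C st) where

    step-at : ∀ {j} (j<x : j < x) → Phase.Step (C (fromℕ< j<x)) (st j) (st (suc j))
    step-at {j} j<x = subst (λ m → Phase.Step (C (fromℕ< j<x)) (st m) (st (suc m)))
                            (toℕ-fromℕ< j<x) (proj₂ execution (fromℕ< j<x))

    active⇒monochrome : ∀ i → i ≤ x → ∀ f → idle (st i) f ≡ false → FixedMonochrome (st i) f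
    active⇒monochrome zero    _   _ _      a _ _ _ a-fixed _ =
      contradiction (trans (sym a-fixed) (cong (λ s → fixed s a) (proj₁ execution))) λ ()
    active⇒monochrome (suc j) j<x _ active = Survivor.monochrome
      where module Survivor = PhaseProperties.Survivor (C (fromℕ< j<x)) (st j) (step-at j<x) active

    active⇒manyUnfixed : α ≤ℚ 1ℚ → (∀ e → ∣ E e ∣ ≡ δ)
                       → ∀ i → i ≤ x → ∀ f → idle (st i) f ≡ false → αδ ≤ℚ ℕ→ℚ ∣ E f ∩ nonFixed (st i) ∣
    active⇒manyUnfixed α≤1 ∣E∣≡δ zero _ f _ =
      subst (λ s → αδ ≤ℚ ℕ→ℚ ∣ E f ∩ nonFixed s ∣) (sym (proj₁ execution))
            (r≤∣p∣∧p⊆q⇒r≤∣q∣ {p = E f} αδ≤∣f∣ (λ v∈f → x∈p∩q⁺ (v∈f , x∈tabulate⁺ _ refl)))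
      where
      αδ≤∣f∣ : αδ ≤ℚ ℕ→ℚ ∣ E f ∣
      αδ≤∣f∣ = subst (λ k → αδ ≤ℚ ℕ→ℚ k) (sym (∣E∣≡δ f)) (≤1⇒*ℕ→ℚ≤ℕ→ℚ α≤1 δ)
    active⇒manyUnfixed α≤1 ∣E∣≡δ (suc j) j<x f active =
      Survivor.unfixed-bound-preserved
        (active⇒manyUnfixed α≤1 ∣E∣≡δ j (ℕ.<⇒≤ j<x) f Survivor.wasActive)
      where module Survivor = PhaseProperties.Survivor (C (fromℕ< j<x)) (st j) (step-at j<x) active

lemma5 : (n δ : ℕ) (α : ℚ) (u x : ℕ)
    → 0ℚ Data.Rational.< α → α Data.Rational.< ½ → 2 < u
    → (E : Fin n → Subset n)
    → Injective _≡_ _≡_ E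
    → (∀ e → ∣ E e ∣ ≡ δ)
    → (C : Fin x → Fin n → Bool)
    → (st : ℕ → State n)
    → Alg.Execution E δ α u x C st
    → ∀ i → i ≤ x → ∀ f → idle (st i) f ≡ false
    → (∀ a b → a ∈ E f → b ∈ E f → fixed (st i) a ≡ true → fixed (st i) b ≡ true
         → colour (st i) a ≡ colour (st i) b)
      × (Alg.αδ E δ α u Data.Rational.≤ ℕ→ℚ ∣ E f ∩ Alg.nonFixed E δ α u (st i) ∣)
lemma5 n δ α u x _ α<½ _ E _ ∣E∣≡δ C st execution i i≤x f active =
  active⇒monochrome i i≤x f active , active⇒manyUnfixed α≤1 ∣E∣≡δ i i≤x f active
  where
  open AlgProperties E δ α u
  open ExecutionProperties x C st execution
  α≤1 : α ≤ℚ 1ℚ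
  α≤1 = ≤-trans (<⇒≤ α<½) (≤ᵇ⇒≤ _)
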